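{- Let $L$ be a finite geometric ranked meet semi-lattice and $k$ a field of characteristic $2$. Then the graded algebra $\bigwedge L$ defined in the context satisfies $f(\bigwedge L)=f(L)$.
   Context: A ranked meet semi-lattice has minimum $\hat 0$, rank function $r$ with $r(\hat 0)=0$ and $r(y)=r(x)+1$ whenever $y$ covers $x$; it is atomic if every element is a join of atoms; a ranked atomic meet semi-lattice is geometric if $r(x\wedge y)+r(x\vee y)\le r(x)+r(y)$ whenever $x\vee y$ exists. Let $L_1$ be the set of atoms and $\hat L$ the lattice obtained by adjoining a maximum $\hat 1$ to $L$ (joins $\vee S$ of sets of atoms are taken in $\hat L$, $\vee\emptyset=\hat 0$). Let $V$ be the $k$-vector space with basis $\{e_u:u\in L_1\}$; fix a total order on $L_1$ and for $S=\{s_1<\dots<s_{|S|}\}\subseteq L_1$ let $e_S=e_{s_1}\wedge\dots\wedge e_{s_{|S|}}$ in the exterior algebra $\bigwedge V$. Let $I_L=I_1+I_2+I_3$ where $I_1$ is the ideal generated by $e_S$ for $S\subseteq L_1$ with $\vee S=\hat 1$; $I_2$ is generated by $e_S$ for $S\subseteq L_1$ with $\vee S\in L$ and $r(\vee S)\ne|S|$; $I_3$ is generated by $e_S-e_T$ for $S\ne T\subseteq L_1$ with $\vee S=\vee T\in L$ and $r(\vee S)=|S|=|T|$. Set $\bigwedge L=\bigwedge V/I_L$, graded by degree. $f(\bigwedge L)=(f_{ -1},f_0,\dots)$ where $f_{i-1}$ is the dimension of the degree $i$ component; $f(L)=(f_{ -1},f_0,\dots)$ where $f_{i}$ is the number of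 elements of $L$ of rank $i+1$. -}

module Defs where

open import Level using (Level; _⊔_) renaming (suc to lsuc)
open import Data.Nat using (ℕ; zero; suc)
import Data.Nat as ℕ
open import Data.Bool using (Bool; true; false; if_then_else_; _∧_)
open import Data.Fin using (Fin)
open import Data.Fin.Subset using (Subset; inside; outside; _∈_; ∣_∣; _∩_; _∪_; ⊥)
open import Data.Vec using ([]; _∷_)
open import Data.Vec.Properties using (≡-dec)
import Data.Bool.Properties as B
open import Data.List using (List; []; _∷_; [_]; map; _++_; foldr; length; filter)
open import Data.List.Relation.Unary.All using (All)
open import Data.Fin using (Fin)
import Data.List as L
open import Data.Product using (Σ; ∃; _×_; _,_)
open import Data.Sum using (_⊎_)
open import Relation.Nullary using (¬_; Dec; yes; no)
open import Relation.Nullary.Decidable using (⌊_⌋)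
open import Relation.Binary.Core using (Rel)
open import Relation.Binary.PropositionalEquality using (_≡_; _≢_)
open import Algebra.Bundles using (CommutativeRing)

record Field (c ℓ : Level) : Set (lsuc (c ⊔ ℓ)) where
  field
    commutativeRing : CommutativeRing c ℓ
  open CommutativeRing commutativeRing public
  field
    1≉0     : ¬ (1# ≈ 0#)
    inverse : ∀ x → ¬ (x ≈ 0#) → ∃ λ y → (x * y) ≈ 1#

Char2 : ∀ {c ℓ} → Field c ℓ → Set ℓ
Char2 K = (1# + 1#) ≈ 0#
  where open Field K

module Poset {ℓo : Level} (m : ℕ) (_≼_ : Rel (Fin m) ℓo) where

  _≺_ : Fin m → Fin m → Set ℓo
  x ≺ y = (x ≼ y) × (x ≢ y)

  _⋖_ : Fin m → Fin m → Set ℓo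
  x ⋖ y = (x ≺ y) × (∀ z → x ≺ z → ¬ (z ≺ y))

  IsLub : ∀ {p} → (Fin m → Set p) → Fin m → Set (ℓo ⊔ p)
  IsLub P z = (∀ u → P u → u ≼ z) × (∀ w → (∀ u → P u → u ≼ w) → z ≼ w)

  JoinOf : Subset m → Fin m → Set (ℓo)
  JoinOf S z = IsLub (_∈ S) z

  module WithBottom (0̂ : Fin m) where

    Atom : Fin m → Set ℓo
    Atom x = 0̂ ⋖ x

    AtomSet : Subset m → Set ℓo
    AtomSet S = ∀ u → u ∈ S → Atom u

    IsRank : (Fin m → ℕ) → Set ℓo
    IsRank r = (r 0̂ ≡ 0) × (∀ x y → x ⋖ y → r y ≡ suc (r x))

    Atomic : Set (ℓo)
    Atomic = ∀ x → ∃ λ S → AtomSet S × JoinOf S x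

    Geometric : (Fin m → Fin m → Fin m) → (Fin m → ℕ) → Set (ℓo)
    Geometric _⊓_ r = ∀ x y z → IsLub (λ u → (u ≡ x) ⊎ (u ≡ y)) z →
                      r (x ⊓ y) ℕ.+ r z ℕ.≤ r x ℕ.+ r y

    countRank : (Fin m → ℕ) → ℕ → ℕ
    countRank r i = length (filter (λ x → r x ℕ.≟ i) (L.allFin m))

allSubsets : ∀ n → List (Subset n)
allSubsets zero    = [ [] ]
allSubsets (suc n) = map (inside ∷_) (allSubsets n) ++ map (outside ∷_) (allSubsets n)

_≟S_ : ∀ {n} (S T : Subset n) → Dec (S ≡ T)
_≟S_ = ≡-dec B._≟_

-- inv R S = #{ (a , b) : a ∈ R , b ∈ S , b < a }
inv : ∀ {n} → Subset n → Subset n → ℕ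
inv []      []      = 0
inv (x ∷ R) (y ∷ S) = (if y then ∣ R ∣ else 0) ℕ.+ inv R S

module Exterior {c ℓ ℓo : Level} (K : Field c ℓ) (m : ℕ)
                (_≼_ : Rel (Fin m) ℓo) (0̂ : Fin m) (r : Fin m → ℕ) where

  open Field K
  open Poset m _≼_
  open WithBottom 0̂

  -- An element of ⋀V written in the basis { e_S : S ⊆ L₁ }:
  -- coefficient functions on subsets, vanishing off subsets of atoms
  -- (see ExtElt).
  Elt : Set c
  Elt = Subset m → Carrier

  ExtElt : Elt → Set (ℓ ⊔ ℓo)
  ExtElt v = ∀ U → ¬ AtomSet U → v U ≈ 0#

  _≐_ : Elt → Elt → Set ℓ
  v ≐ w = ∀ U → v U ≈ w U

  sumL : List Carrier → Carrier
  sumL = foldr _+_ 0#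

  zeroE : Elt
  zeroE _ = 0#

  _⊕_ : Elt → Elt → Elt
  (v ⊕ w) U = v U + w U

  _⊖_ : Elt → Elt → Elt
  (v ⊖ w) U = v U + (- w U)

  _⊙_ : Carrier → Elt → Elt
  (a ⊙ v) U = a * v U

  -- basis element e_S = e_{s₁} ∧ ⋯ ∧ e_{sₖ}  (s₁ < ⋯ < sₖ)
  e : Subset m → Elt
  e S U = if ⌊ S ≟S U ⌋ then 1# else 0#

  sign : ℕ → Carrier
  sign zero    = 1#
  sign (suc k) = - sign k

  -- e_R ∧ e_S = (-1)^{inv R S} e_{R ∪ S} if R ∩ S = ∅, and 0 otherwise
  coef : Subset m → Subset m → Subset m → Carrier
  coef R S U = if ⌊ (R ∩ S) ≟S ⊥ ⌋ ∧ ⌊ (R ∪ S) ≟S U ⌋ then sign (inv R S) else 0#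

  _⋏_ : Elt → Elt → Elt
  (v ⋏ w) U = sumL (map (λ R → sumL (map (λ S → coef R S U * (v R * w S))
                                          (allSubsets m)))
                        (allSubsets m))

  IsGen : Elt → Set (ℓ ⊔ ℓo)
  IsGen g =
      (∃ λ S → AtomSet S × ¬ (∃ λ z → JoinOf S z) × (g ≐ e S))
    ⊎ (∃ λ S → ∃ λ z → AtomSet S × JoinOf S z × (r z ≢ ∣ S ∣) × (g ≐ e S))
    ⊎ (∃ λ S → ∃ λ T → ∃ λ z → (S ≢ T) × AtomSet S × AtomSet T ×
         JoinOf S z × JoinOf T z × (r z ≡ ∣ S ∣) × (r z ≡ ∣ T ∣) ×
         (g ≐ (e S ⊖ e T)))

  InIdeal : Elt → Set (c ⊔ ℓ ⊔ ℓo)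
  InIdeal v = ∃ λ (ts : List (Elt × Elt × Elt)) →
      All (λ { (x , g , y) → ExtElt x × IsGen g × ExtElt y }) ts ×
      (v ≐ foldr (λ { (x , g , y) acc → ((x ⋏ g) ⋏ y) ⊕ acc }) zeroE ts)

  InDeg : ℕ → Elt → Set (ℓ ⊔ ℓo)
  InDeg i v = ExtElt v × (∀ U → ∣ U ∣ ≢ i → v U ≈ 0#)

  lincomb : ∀ {d} → (Fin d → Elt) → (Fin d → Carrier) → Elt
  lincomb {d} b a = foldr (λ j acc → (a j ⊙ b j) ⊕ acc) zeroE (L.allFin d)

  -- dim_k (⋀L)_i = d : the degree i component (⋀V)_i / (I_L ∩ (⋀V)_i)
  -- has a basis given by the classes of d elements b₁,…,b_d of (⋀V)_i
  DimDeg : ℕ → ℕ → Set (c ⊔ ℓ ⊔ ℓo)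
  DimDeg i d = ∃ λ (b : Fin d → Elt) →
      (∀ j → InDeg i (b j)) ×
      (∀ a → InIdeal (lincomb b a) → ∀ j → a j ≈ 0#) ×
      (∀ v → InDeg i v → ∃ λ a → InIdeal (v ⊖ lincomb b a))

{-# OPTIONS --safe #-}
-- In characteristic 2 the signs of ⋀V disappear: e_R ∧ e_S = [R ∩ S = ∅] e_{R ∪ S}.  For x ∈ L let
-- φ_x(v) = Σ v_U over the bases U of x (sets of r x atoms with join x).  Paired with p ∧ g ∧ q, φ_x
-- becomes a linear combination of functions of S which vanish when S is dependent and take equal
-- values on two bases of the same flat (exchange of bases in a geometric semilattice); every such
-- function kills every generator of I_L, so φ_x vanishes on I_L.  Choosing a basis S_x of each x of
-- rank i, φ_x(e_{S_y}) = δ_{xy} makes the e_{S_x} independent modulo I_L, and they span: a degree i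
-- monomial e_U is a generator of I₁ or I₂ unless U is a basis of some x of rank i, and then
-- e_U ≡ e_{S_x} modulo I₃.

module Submission where

open import Defs
open import Level using (Level; _⊔_)
open import Algebra.Bundles using (CommutativeRing)
open import Data.Bool using (Bool; true; false; T; _∧_; if_then_else_)
open import Data.Bool.Properties using (T-∧)
open import Data.Empty using (⊥-elim)
open import Data.Fin using (Fin)
import Data.Fin as Fin
import Data.Fin.Properties as Fin
open import Data.Fin.Subset using (Subset; inside; outside; _∈_; _∉_; _⊆_; _⊂_; ∣_∣; _∩_; _∪_; ⊥; ⁅_⁆)
open import Data.Fin.Subset.Properties
  using (_∈?_; Empty-unique; x∈p∩q⁻; x∈p∩q⁺; x∈p∪q⁻; x∈p∪q⁺; ∉⊥; x∈⁅x⁆; x∈⁅y⁆⇒x≡y; ∣⁅x⁆∣≡1; ∣⊥∣≡0;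
         p⊆q⇒∣p∣≤∣q∣; p⊂q⇒∣p∣<∣q∣; p⊆p∪q; q⊆p∪q; ⊆-min;
         ∩-zeroˡ; ∩-zeroʳ; ∪-identityˡ; ∪-identityʳ; ∪-assoc; ∪-comm)
open import Data.List using (List; []; _∷_; _++_; map; foldr; filter; length; lookup; allFin)
open import Data.List.Membership.Propositional using () renaming (_∈_ to _∈ₗ_)
open import Data.List.Membership.Propositional.Properties
  using (∈-lookup; ∈-filter⁺; ∈-filter⁻; ∈-allFin; ∈-map⁺; ∈-map⁻; ∈-++⁺ˡ; ∈-++⁺ʳ)
open import Data.List.Relation.Unary.All as All using (All; []; _∷_; universal)
import Data.List.Relation.Unary.All.Properties as All
open import Data.List.Relation.Unary.AllPairs using ([]; _∷_)
open import Data.List.Relation.Unary.Any using (here; there; index)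
open import Data.List.Relation.Unary.Any.Properties using (lookup-index)
open import Data.List.Relation.Unary.Unique.Propositional using (Unique)
import Data.List.Relation.Unary.Unique.Propositional.Properties as Unique
open import Data.Nat using (ℕ; zero; suc; s≤s⁻¹)
import Data.Nat as Nat
import Data.Nat.Properties as ℕₚ
open import Data.Product using (∃; _×_; _,_; proj₁; proj₂; uncurry)
open import Data.Sum using (_⊎_; inj₁; inj₂)
open import Data.Vec using ([]; _∷_; tail; tabulate)
open import Data.Vec.Properties using (∷-injectiveʳ; lookup∘tabulate; []=⇒lookup; lookup⇒[]=)
open import Function using (_∘_)
open import Function.Bundles using (Equivalence; mk⇔)
open import Relation.Binary.Core using (Rel)
open import Relation.Binary.Definitions using (DecidableEquality; Decidable; Minimum)
open import Relation.Binary.Lattice using (IsMeetSemilattice)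
open import Relation.Binary.PropositionalEquality using (_≡_; _≢_)
import Relation.Binary.PropositionalEquality as ≡
open import Relation.Nullary using (Dec; yes; no; ¬_)
open import Relation.Nullary.Decidable
  using (⌊_⌋; map′; _×-dec_; _→-dec_; ¬?; toWitness; fromWitness; isYes≗does; dec-true; dec-false; does-⇔)

module _ {p} {P : Set p} where

  ⌊⌋-yes : (p? : Dec P) → P → ⌊ p? ⌋ ≡ true
  ⌊⌋-yes p? x = ≡.trans (isYes≗does p?) (dec-true p? x)

  ⌊⌋-no : (p? : Dec P) → ¬ P → ⌊ p? ⌋ ≡ false
  ⌊⌋-no p? ¬x = ≡.trans (isYes≗does p?) (dec-false p? ¬x)

  ⌊⌋-⇔ : ∀ {q} {Q : Set q} (p? : Dec P) (q? : Dec Q) → (P → Q) → (Q → P) → ⌊ p? ⌋ ≡ ⌊ q? ⌋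
  ⌊⌋-⇔ p? q? to from =
    ≡.trans (isYes≗does p?) (≡.trans (does-⇔ (mk⇔ to from) p? q?) (≡.sym (isYes≗does q?)))

module _ {a} {A : Set a} (_≟_ : DecidableEquality A) where

  ⌊≟⌋-sym : ∀ x y → ⌊ x ≟ y ⌋ ≡ ⌊ y ≟ x ⌋
  ⌊≟⌋-sym x y = ⌊⌋-⇔ (x ≟ y) (y ≟ x) ≡.sym ≡.sym

T-injective : ∀ {a b} → (T a → T b) → (T b → T a) → a ≡ b
T-injective {false} {false} _   _   = ≡.refl
T-injective {false} {true}  _   b⇒a = ⊥-elim (b⇒a _)
T-injective {true}  {false} a⇒b _   = ⊥-elim (a⇒b _)
T-injective {true}  {true}  _   _   = ≡.refl

lookup-injective : ∀ {a} {A : Set a} {xs : List A} → Unique xs → ∀ {i j} → lookup xs i ≡ lookup xs j → i ≡ j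
lookup-injective (_   ∷ _)      {Fin.zero}  {Fin.zero}  _  = ≡.refl
lookup-injective (x∉xs ∷ _)     {Fin.zero}  {Fin.suc j} eq = ⊥-elim (All.lookup x∉xs (∈-lookup j) eq)
lookup-injective (x∉xs ∷ _)     {Fin.suc i} {Fin.zero}  eq = ⊥-elim (All.lookup x∉xs (∈-lookup i) (≡.sym eq))
lookup-injective (_   ∷ unique) {Fin.suc i} {Fin.suc j} eq = ≡.cong Fin.suc (lookup-injective unique eq)

allSubsets-complete : ∀ {n} (S : Subset n) → S ∈ₗ allSubsets n
allSubsets-complete []            = here ≡.refl
allSubsets-complete (inside  ∷ S) = ∈-++⁺ˡ (∈-map⁺ (inside ∷_) (allSubsets-complete S))
allSubsets-complete (outside ∷ S) = ∈-++⁺ʳ _ (∈-map⁺ (outside ∷_) (allSubsets-complete S))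

allSubsets-unique : ∀ n → Unique (allSubsets n)
allSubsets-unique zero    = [] ∷ []
allSubsets-unique (suc n) = Unique.++⁺ (Unique.map⁺ ∷-injectiveʳ unique) (Unique.map⁺ ∷-injectiveʳ unique) disjoint
  where
  unique = allSubsets-unique n
  disjoint : ∀ {v} → ¬ (v ∈ₗ map (inside ∷_) (allSubsets n) × v ∈ₗ map (outside ∷_) (allSubsets n))
  disjoint (∈insides , ∈outsides) with ∈-map⁻ (inside ∷_) ∈insides | ∈-map⁻ (outside ∷_) ∈outsides
  ... | _ , _ , ≡.refl | _ , _ , ()

module _ {n : ℕ} where

  ∩≡⊥⁺ : {p q : Subset n} → (∀ {x} → x ∈ p → x ∉ q) → p ∩ q ≡ ⊥
  ∩≡⊥⁺ {p} {q} h = Empty-unique λ (x , x∈p∩q) → uncurry h (x∈p∩q⁻ p q x∈p∩q)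

  ∩≡⊥⁻ : {p q : Subset n} → p ∩ q ≡ ⊥ → ∀ {x} → x ∈ p → x ∉ q
  ∩≡⊥⁻ p∩q≡⊥ x∈p x∈q = ∉⊥ (≡.subst (_ ∈_) p∩q≡⊥ (x∈p∩q⁺ (x∈p , x∈q)))

∣p∪q∣≡∣p∣+∣q∣ : ∀ {n} (p q : Subset n) → p ∩ q ≡ ⊥ → ∣ p ∪ q ∣ ≡ ∣ p ∣ Nat.+ ∣ q ∣
∣p∪q∣≡∣p∣+∣q∣ []            []            _  = ≡.refl
∣p∪q∣≡∣p∣+∣q∣ (inside  ∷ p) (inside  ∷ q) ()
∣p∪q∣≡∣p∣+∣q∣ (inside  ∷ p) (outside ∷ q) eq = ≡.cong suc (∣p∪q∣≡∣p∣+∣q∣ p q (≡.cong tail eq))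
∣p∪q∣≡∣p∣+∣q∣ (outside ∷ p) (inside  ∷ q) eq =
  ≡.trans (≡.cong suc (∣p∪q∣≡∣p∣+∣q∣ p q (≡.cong tail eq))) (≡.sym (ℕₚ.+-suc ∣ p ∣ ∣ q ∣))
∣p∪q∣≡∣p∣+∣q∣ (outside ∷ p) (outside ∷ q) eq = ∣p∪q∣≡∣p∣+∣q∣ p q (≡.cong tail eq)

∪⁅⁆⊆ : ∀ {n} {p q : Subset n} {x} → p ⊆ q → x ∈ q → p ∪ ⁅ x ⁆ ⊆ q
∪⁅⁆⊆ {p = p} {q} {x} p⊆q x∈q y∈p∪⁅x⁆ with x∈p∪q⁻ p ⁅ x ⁆ y∈p∪⁅x⁆
... | inj₁ y∈p   = p⊆q y∈p
... | inj₂ y∈⁅x⁆ = ≡.subst (_∈ q) (≡.sym (x∈⁅y⁆⇒x≡y x y∈⁅x⁆)) x∈q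

∣p∪⁅x⁆∣≡1+∣p∣ : ∀ {n} {p : Subset n} {x} → x ∉ p → ∣ p ∪ ⁅ x ⁆ ∣ ≡ suc ∣ p ∣
∣p∪⁅x⁆∣≡1+∣p∣ {p = p} {x} x∉p = begin
  ∣ p ∪ ⁅ x ⁆ ∣          ≡⟨ ∣p∪q∣≡∣p∣+∣q∣ p ⁅ x ⁆ (∩≡⊥⁺ λ y∈p y∈⁅x⁆ →
                                x∉p (≡.subst (_∈ p) (x∈⁅y⁆⇒x≡y x y∈⁅x⁆) y∈p)) ⟩
  ∣ p ∣ Nat.+ ∣ ⁅ x ⁆ ∣  ≡⟨ ≡.cong (∣ p ∣ Nat.+_) (∣⁅x⁆∣≡1 x) ⟩
  ∣ p ∣ Nat.+ 1          ≡⟨ ℕₚ.+-comm ∣ p ∣ 1 ⟩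
  suc ∣ p ∣              ∎
  where open ≡.≡-Reasoning

disjoint? : ∀ {n} → Subset n → Subset n → Bool
disjoint? p q = ⌊ (p ∩ q) ≟S ⊥ ⌋

module _ {n : ℕ} where

  disjoint?⁺ : {p q : Subset n} → (∀ {x} → x ∈ p → x ∉ q) → T (disjoint? p q)
  disjoint?⁺ = fromWitness ∘ ∩≡⊥⁺

  disjoint?⁻ : {p q : Subset n} → T (disjoint? p q) → ∀ {x} → x ∈ p → x ∉ q
  disjoint?⁻ = ∩≡⊥⁻ ∘ toWitness

  -- ⌊_⌋ does not compute through ≡-dec, so this is proved via T rather than by evaluation.
  disjoint?-swap : (p q s : Subset n) →
                   disjoint? p q ∧ disjoint? (p ∪ q) s ≡ disjoint? p s ∧ disjoint? (p ∪ s) q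
  disjoint?-swap p q s = T-injective (swap p q s) (swap p s q)
    where
    swap : ∀ p q s → T (disjoint? p q ∧ disjoint? (p ∪ q) s) → T (disjoint? p s ∧ disjoint? (p ∪ s) q)
    swap p q s h = Equivalence.from T-∧ (disjoint?⁺ p∉s , disjoint?⁺ p∪s∉q)
      where
      p∉q = disjoint?⁻ (proj₁ (Equivalence.to T-∧ h))
      p∪q∉s = disjoint?⁻ (proj₂ (Equivalence.to T-∧ h))
      p∉s : ∀ {x} → x ∈ p → x ∉ s
      p∉s x∈p = p∪q∉s (x∈p∪q⁺ (inj₁ x∈p))
      p∪s∉q : ∀ {x} → x ∈ p ∪ s → x ∉ q
      p∪s∉q x∈p∪s x∈q with x∈p∪q⁻ p s x∈p∪s
      ... | inj₁ x∈p = p∉q x∈p x∈q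
      ... | inj₂ x∈s = p∪q∉s (x∈p∪q⁺ (inj₂ x∈q)) x∈s

module _ {n p} {P : Fin n → Set p} (P? : ∀ x → Dec (P x)) where

  subset : Subset n
  subset = tabulate λ x → ⌊ P? x ⌋

  ∈-subset⁺ : ∀ {x} → P x → x ∈ subset
  ∈-subset⁺ {x} px = lookup⇒[]= x subset (≡.trans (lookup∘tabulate _ x) (⌊⌋-yes (P? x) px))

  ∈-subset⁻ : ∀ {x} → x ∈ subset → P x
  ∈-subset⁻ {x} x∈ with P? x | ≡.trans (≡.sym (lookup∘tabulate _ x)) ([]=⇒lookup x∈)
  ... | yes px | _ = px

module _ {n p} {P : Fin n → Set p} where

  ∀∈-∪⁺ : ∀ {A B} → (∀ u → u ∈ A → P u) → (∀ u → u ∈ B → P u) → ∀ u → u ∈ A ∪ B → P u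
  ∀∈-∪⁺ {A} {B} PA PB u u∈A∪B with x∈p∪q⁻ A B u∈A∪B
  ... | inj₁ u∈A = PA u u∈A
  ... | inj₂ u∈B = PB u u∈B

  ∀∈-∪⁻ˡ : ∀ {A B} → (∀ u → u ∈ A ∪ B → P u) → ∀ u → u ∈ A → P u
  ∀∈-∪⁻ˡ PA∪B u u∈A = PA∪B u (x∈p∪q⁺ (inj₁ u∈A))

  ∀∈-∪⁻ʳ : ∀ {A B} → (∀ u → u ∈ A ∪ B → P u) → ∀ u → u ∈ B → P u
  ∀∈-∪⁻ʳ PA∪B u u∈B = PA∪B u (x∈p∪q⁺ (inj₂ u∈B))

  ∀∈-⁅⁆ : ∀ {a} → P a → ∀ u → u ∈ ⁅ a ⁆ → P u
  ∀∈-⁅⁆ {a} Pa u u∈⁅a⁆ = ≡.subst P (≡.sym (x∈⁅y⁆⇒x≡y a u∈⁅a⁆)) Pa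

  ∀∈-⊥ : ∀ u → u ∈ ⊥ → P u
  ∀∈-⊥ u u∈⊥ = ⊥-elim (∉⊥ u∈⊥)

module ListSum {c ℓ} (R : CommutativeRing c ℓ) where
  open CommutativeRing R
  open import Algebra.Properties.CommutativeSemigroup +-commutativeSemigroup
    using () renaming (interchange to +-interchange)
  open import Relation.Binary.Reasoning.Setoid setoid

  ∑ : ∀ {a} {A : Set a} → List A → (A → Carrier) → Carrier
  ∑ xs f = foldr _+_ 0# (map f xs)

  syntax ∑ xs (λ x → f) = ∑[ x ← xs ] f

  ⟦_⟧ : Bool → Carrier
  ⟦ b ⟧ = if b then 1# else 0#

  ⟦⟧-false : ∀ {b} → ¬ T b → ⟦ b ⟧ ≈ 0#
  ⟦⟧-false {false} _  = refl
  ⟦⟧-false {true}  ¬t = ⊥-elim (¬t _)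

  ⟦∧⟧ : ∀ a b → ⟦ a ∧ b ⟧ ≈ ⟦ a ⟧ * ⟦ b ⟧
  ⟦∧⟧ true  b = sym (*-identityˡ ⟦ b ⟧)
  ⟦∧⟧ false b = sym (zeroˡ ⟦ b ⟧)

  module _ {a} {A : Set a} where

    ∑-cong : ∀ xs {f g : A → Carrier} → (∀ x → f x ≈ g x) → ∑ xs f ≈ ∑ xs g
    ∑-cong []       f≈g = refl
    ∑-cong (x ∷ xs) f≈g = +-cong (f≈g x) (∑-cong xs f≈g)

    ∑-zero : ∀ {xs} {f : A → Carrier} → All (λ x → f x ≈ 0#) xs → ∑ xs f ≈ 0#
    ∑-zero []           = refl
    ∑-zero (fx≈0 ∷ f≈0) = trans (+-cong fx≈0 (∑-zero f≈0)) (+-identityˡ 0#)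

    ∑-+ : ∀ xs (f g : A → Carrier) → ∑[ x ← xs ] (f x + g x) ≈ ∑ xs f + ∑ xs g
    ∑-+ []       f g = sym (+-identityˡ 0#)
    ∑-+ (x ∷ xs) f g = trans (+-congˡ (∑-+ xs f g)) (+-interchange (f x) (g x) (∑ xs f) (∑ xs g))

    ∑-*ˡ : ∀ xs k (f : A → Carrier) → k * ∑ xs f ≈ ∑[ x ← xs ] (k * f x)
    ∑-*ˡ []       k f = zeroʳ k
    ∑-*ˡ (x ∷ xs) k f = trans (distribˡ k (f x) (∑ xs f)) (+-congˡ (∑-*ˡ xs k f))

    ∑-*ʳ : ∀ xs k (f : A → Carrier) → ∑ xs f * k ≈ ∑[ x ← xs ] (f x * k)
    ∑-*ʳ xs k f = trans (*-comm _ k) (trans (∑-*ˡ xs k f) (∑-cong xs λ x → *-comm k (f x)))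

  ∑-comm : ∀ {a b} {A : Set a} {B : Set b} xs ys (f : A → B → Carrier) →
           ∑[ x ← xs ] ∑[ y ← ys ] f x y ≈ ∑[ y ← ys ] ∑[ x ← xs ] f x y
  ∑-comm []       ys f = sym (∑-zero (All.universal (λ _ → refl) ys))
  ∑-comm (x ∷ xs) ys f =
    trans (+-congˡ (∑-comm xs ys f)) (sym (∑-+ ys (f x) (λ y → ∑[ x ← xs ] f x y)))

  module _ {a} {A : Set a} (_≟_ : DecidableEquality A) (f : A → Carrier) where

    ∑-absent : ∀ {k xs} → All (k ≢_) xs → ∑[ x ← xs ] (⟦ ⌊ k ≟ x ⌋ ⟧ * f x) ≈ 0#
    ∑-absent {k} = ∑-zero ∘ All.map λ {x} k≢x →
      trans (*-congʳ (reflexive (≡.cong ⟦_⟧ (⌊⌋-no (k ≟ x) k≢x)))) (zeroˡ (f x))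

    ∑-δ : ∀ {k xs} → Unique xs → k ∈ₗ xs → ∑[ x ← xs ] (⟦ ⌊ k ≟ x ⌋ ⟧ * f x) ≈ f k
    ∑-δ {k} (k∉xs ∷ _) (here ≡.refl) = begin
      ⟦ ⌊ k ≟ k ⌋ ⟧ * f k + _  ≈⟨ +-cong ⟦k≟k⟧*fk≈fk (∑-absent k∉xs) ⟩
      f k + 0#                 ≈⟨ +-identityʳ (f k) ⟩
      f k                      ∎
      where ⟦k≟k⟧*fk≈fk = trans (*-congʳ (reflexive (≡.cong ⟦_⟧ (⌊⌋-yes (k ≟ k) ≡.refl)))) (*-identityˡ (f k))
    ∑-δ {k} {x ∷ _} (x∉xs ∷ xs-unique) (there k∈xs) = begin
      ⟦ ⌊ k ≟ x ⌋ ⟧ * f x + _  ≈⟨ +-cong ⟦k≟x⟧*fx≈0 (∑-δ xs-unique k∈xs) ⟩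
      0# + f k                 ≈⟨ +-identityˡ (f k) ⟩
      f k                      ∎
      where
      k≢x : k ≢ x
      k≢x k≡x = All.lookup x∉xs k∈xs (≡.sym k≡x)
      ⟦k≟x⟧*fx≈0 = trans (*-congʳ (reflexive (≡.cong ⟦_⟧ (⌊⌋-no (k ≟ x) k≢x)))) (zeroˡ (f x))

module GeometricSemilattice
    {ℓo : Level} (m : ℕ) (_≼_ : Rel (Fin m) ℓo) (_⊓_ : Fin m → Fin m → Fin m)
    (isMeetSemilattice : IsMeetSemilattice _≡_ _≼_ _⊓_)
    (0̂ : Fin m) (0̂-minimum : Minimum _≼_ 0̂)
    (r : Fin m → ℕ) (isRank : Poset.WithBottom.IsRank m _≼_ 0̂ r)
    (geometric : Poset.WithBottom.Geometric m _≼_ 0̂ _⊓_ r) where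

  open Nat using (_+_; _≤_; _<_)
  open ℕₚ using (module ≤-Reasoning; ≤-reflexive; ≤-trans; ≤-antisym; <-trans; <-≤-trans; n<1+n; <-irrefl;
                 +-comm; +-suc; +-identityʳ; +-monoʳ-≤; +-monoˡ-≤; +-cancelʳ-≤; m+n≤o⇒n≤o; m≤m+n; <⇒≢)
  open Poset m _≼_
  open WithBottom 0̂
  open IsMeetSemilattice isMeetSemilattice
    using (antisym; x∧y≤x; x∧y≤y; ∧-greatest) renaming (refl to ≼-refl; trans to ≼-trans)

  _≼?_ : Decidable _≼_
  x ≼? y = map′ (λ x⊓y≡x → ≡.subst (_≼ y) x⊓y≡x (x∧y≤y x y))
                (λ x≼y → antisym (x∧y≤x x y) (∧-greatest ≼-refl x≼y))
                ((x ⊓ y) Fin.≟ x)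

  _≺?_ : Decidable _≺_
  x ≺? y = x ≼? y ×-dec ¬? (x Fin.≟ y)

  _⋖?_ : Decidable _⋖_
  x ⋖? y = x ≺? y ×-dec Fin.all? λ z → x ≺? z →-dec ¬? (z ≺? y)

  atomSet? : ∀ S → Dec (AtomSet S)
  atomSet? S = Fin.all? λ u → u ∈? S →-dec 0̂ ⋖? u

  UpperBound : Subset m → Fin m → Set ℓo
  UpperBound S w = ∀ u → u ∈ S → u ≼ w

  upperBound? : ∀ S w → Dec (UpperBound S w)
  upperBound? S w = Fin.all? λ u → u ∈? S →-dec u ≼? w

  joinOf? : ∀ S z → Dec (JoinOf S z)
  joinOf? S z = upperBound? S z ×-dec Fin.all? λ w → upperBound? S w →-dec z ≼? w

  join-unique : ∀ {S z z′} → JoinOf S z → JoinOf S z′ → z ≡ z′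
  join-unique (z-ub , z-least) (z′-ub , z′-least) = antisym (z-least _ z′-ub) (z′-least _ z-ub)

  join-upper : ∀ {S z w} → JoinOf S z → z ≼ w → UpperBound S w
  join-upper (z-ub , _) z≼w u u∈S = ≼-trans (z-ub u u∈S) z≼w

  join-mono : ∀ {A B x y} → A ⊆ B → JoinOf A x → JoinOf B y → x ≼ y
  join-mono A⊆B (_ , x-least) (y-ub , _) = x-least _ λ u u∈A → y-ub u (A⊆B u∈A)

  join-⊥ : JoinOf ⊥ 0̂
  join-⊥ = ∀∈-⊥ , λ w _ → 0̂-minimum w

  join-⁅⁆ : ∀ a → JoinOf ⁅ a ⁆ a
  join-⁅⁆ a = ∀∈-⁅⁆ ≼-refl , λ w ub → ub a (x∈⁅x⁆ a)

  join-∪-replace : ∀ {A S T x z} → JoinOf S z → JoinOf T z → JoinOf (A ∪ S) x → JoinOf (A ∪ T) x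
  join-∪-replace S∨z T∨z (x-ub , x-least) =
    ∀∈-∪⁺ (∀∈-∪⁻ˡ x-ub) (join-upper T∨z (proj₂ S∨z _ (∀∈-∪⁻ʳ x-ub))) ,
    λ w A∪T≼w → x-least w (∀∈-∪⁺ (∀∈-∪⁻ˡ A∪T≼w) (join-upper S∨z (proj₂ T∨z _ (∀∈-∪⁻ʳ A∪T≼w))))

  join-∪-absorb : ∀ {S B z} → JoinOf S z → UpperBound B z → JoinOf (S ∪ B) z
  join-∪-absorb (z-ub , z-least) B≼z = ∀∈-∪⁺ z-ub B≼z , λ w ub → z-least w (∀∈-∪⁻ˡ ub)

  join-∪⁅⁆-isLub : ∀ {A a x z} → JoinOf A x → JoinOf (A ∪ ⁅ a ⁆) z → IsLub (λ u → u ≡ x ⊎ u ≡ a) z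
  join-∪⁅⁆-isLub {a = a} A∨x (z-ub , z-least) = ub , λ w ub′ →
      z-least w (∀∈-∪⁺ (join-upper A∨x (ub′ _ (inj₁ ≡.refl))) (join-upper (join-⁅⁆ a) (ub′ a (inj₂ ≡.refl))))
    where
    ub : ∀ u → u ≡ _ ⊎ u ≡ a → u ≼ _
    ub u (inj₁ ≡.refl) = proj₂ A∨x _ (∀∈-∪⁻ˡ z-ub)
    ub u (inj₂ ≡.refl) = ∀∈-∪⁻ʳ z-ub a (x∈⁅x⁆ a)

  -- The meet of all upper bounds of S.
  join-exists : ∀ {S w} → UpperBound S w → ∃ (JoinOf S)
  join-exists {S} {w} S≼w =
    ⋀ bounds ,
    (λ u u∈S → ⋀-greatest u bounds (S≼w u u∈S) (All.map (λ ub → ub u u∈S) bounds-ub)) ,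
    λ v S≼v → ⋀-lower bounds (∈-filter⁺ (upperBound? S) (∈-allFin v) S≼v)
    where
    bounds = filter (upperBound? S) (allFin m)
    bounds-ub : All (UpperBound S) bounds
    bounds-ub = All.all-filter (upperBound? S) (allFin m)
    ⋀ : List (Fin m) → Fin m
    ⋀ = foldr _⊓_ w
    ⋀-lower : ∀ vs {v} → v ∈ₗ vs → ⋀ vs ≼ v
    ⋀-lower (v ∷ vs) (here ≡.refl) = x∧y≤x v (⋀ vs)
    ⋀-lower (v ∷ vs) (there v∈vs)  = ≼-trans (x∧y≤y v (⋀ vs)) (⋀-lower vs v∈vs)
    ⋀-greatest : ∀ u vs → u ≼ w → All (u ≼_) vs → u ≼ ⋀ vs
    ⋀-greatest u []       u≼w []          = u≼w
    ⋀-greatest u (v ∷ vs) u≼w (u≼v ∷ u≼vs) = ∧-greatest u≼v (⋀-greatest u vs u≼w u≼vs)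

  rank-0̂ : r 0̂ ≡ 0
  rank-0̂ = proj₁ isRank

  rank-⋖ : ∀ {x y} → x ⋖ y → r y ≡ suc (r x)
  rank-⋖ = proj₂ isRank _ _

  rank-atom : ∀ {a} → Atom a → r a ≡ 1
  rank-atom 0̂⋖a = ≡.trans (rank-⋖ 0̂⋖a) (≡.cong suc rank-0̂)

  interval : Fin m → Fin m → Subset m
  interval x y = subset λ w → x ≼? w ×-dec w ≼? y

  interval-⊂ˡ : ∀ {x y z} → x ≺ z → z ≼ y → interval z y ⊂ interval x y
  interval-⊂ˡ {x} (x≼z , x≢z) z≼y =
    (λ w∈ → let z≼w , w≼y = ∈-subset⁻ _ w∈ in ∈-subset⁺ _ (≼-trans x≼z z≼w , w≼y)) ,
    x , ∈-subset⁺ _ (≼-refl , ≼-trans x≼z z≼y) , λ x∈ → x≢z (antisym x≼z (proj₁ (∈-subset⁻ _ x∈)))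

  interval-⊂ʳ : ∀ {x y z} → x ≼ z → z ≺ y → interval x z ⊂ interval x y
  interval-⊂ʳ {y = y} x≼z (z≼y , z≢y) =
    (λ w∈ → let x≼w , w≼z = ∈-subset⁻ _ w∈ in ∈-subset⁺ _ (x≼w , ≼-trans w≼z z≼y)) ,
    y , ∈-subset⁺ _ (≼-trans x≼z z≼y , ≼-refl) , λ y∈ → z≢y (antisym z≼y (proj₂ (∈-subset⁻ _ y∈)))

  -- Split x ≺ y at an intermediate element until only covers remain; the interval [x, y] shrinks.
  rank-strictMono : ∀ {x y} → x ≺ y → r x < r y
  rank-strictMono {x} {y} = go (suc ∣ interval x y ∣) (n<1+n _)
    where
    go : ∀ n {x y} → ∣ interval x y ∣ < n → x ≺ y → r x < r y
    go (suc n) {x} {y} I<n x≺y with Fin.any? (λ z → x ≺? z ×-dec z ≺? y)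
    ... | no ∄z = ≤-reflexive (≡.sym (rank-⋖ (x≺y , λ z x≺z z≺y → ∄z (z , x≺z , z≺y))))
    ... | yes (z , x≺z , z≺y) =
      <-trans (go n (<-≤-trans (p⊂q⇒∣p∣<∣q∣ (interval-⊂ʳ (proj₁ x≺z) z≺y)) (s≤s⁻¹ I<n)) x≺z)
              (go n (<-≤-trans (p⊂q⇒∣p∣<∣q∣ (interval-⊂ˡ x≺z (proj₁ z≺y))) (s≤s⁻¹ I<n)) z≺y)

  rank-adjoin-≤ : ∀ {A a x z} → JoinOf A x → Atom a → JoinOf (A ∪ ⁅ a ⁆) z → r z ≤ suc (r x)
  rank-adjoin-≤ {A} {a} {x} {z} A∨x 0̂⋖a A+a∨z = ≤-trans r[z]≤r[x]+r[a] (≤-reflexive r[x]+r[a]≡1+r[x])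
    where
    r[z]≤r[x]+r[a] : r z ≤ r x + r a
    r[z]≤r[x]+r[a] = m+n≤o⇒n≤o (r (x ⊓ a)) (geometric x a z (join-∪⁅⁆-isLub A∨x A+a∨z))
    r[x]+r[a]≡1+r[x] : r x + r a ≡ suc (r x)
    r[x]+r[a]≡1+r[x] = ≡.trans (≡.cong (r x +_) (rank-atom 0̂⋖a)) (+-comm (r x) 1)

  -- Adjoin the atoms of B ∖ A one at a time; each raises the rank by at most one.
  rank-join-⊆ : ∀ {A B x y} → A ⊆ B → AtomSet B → JoinOf A x → JoinOf B y → r y + ∣ A ∣ ≤ r x + ∣ B ∣
  rank-join-⊆ {A} {B} A⊆B atoms = go ∣ B ∣ (m≤m+n ∣ B ∣ ∣ A ∣) A⊆B
    where
    go : ∀ k {A x y} → ∣ B ∣ ≤ k + ∣ A ∣ → A ⊆ B → JoinOf A x → JoinOf B y → r y + ∣ A ∣ ≤ r x + ∣ B ∣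
    go k {A} {x} {y} B≤k+A A⊆B A∨x B∨y with Fin.any? (λ a → a ∈? B ×-dec ¬? (a ∈? A))
    ... | no ∄a =
      ≡.subst (λ t → r y + ∣ A ∣ ≤ r t + ∣ B ∣) (join-unique A∨y A∨x) (+-monoʳ-≤ (r y) (p⊆q⇒∣p∣≤∣q∣ A⊆B))
      where
      B⊆A : B ⊆ A
      B⊆A {a} a∈B with a ∈? A
      ... | yes a∈A = a∈A
      ... | no  a∉A = ⊥-elim (∄a (a , a∈B , a∉A))
      A∨y : JoinOf A y
      A∨y = (λ u u∈A → proj₁ B∨y u (A⊆B u∈A)) , λ w A≼w → proj₂ B∨y w λ u u∈B → A≼w u (B⊆A u∈B)
    ... | yes (a , a∈B , a∉A) with k
    ...   | zero  = ⊥-elim (<-irrefl ≡.refl (<-≤-trans (p⊂q⇒∣p∣<∣q∣ (A⊆B , a , a∈B , a∉A)) B≤k+A))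
    ...   | suc k with join-exists (λ u u∈A′ → proj₁ B∨y u (∪⁅⁆⊆ A⊆B a∈B u∈A′))
    ...     | x′ , A′∨x′ = s≤s⁻¹ (begin
      suc (r y + ∣ A ∣)   ≡⟨ ≡.sym (+-suc (r y) ∣ A ∣) ⟩
      r y + suc ∣ A ∣     ≡⟨ ≡.cong (r y +_) (≡.sym ∣A′∣≡1+∣A∣) ⟩
      r y + ∣ A ∪ ⁅ a ⁆ ∣ ≤⟨ go k B≤k+A′ (∪⁅⁆⊆ A⊆B a∈B) A′∨x′ B∨y ⟩
      r x′ + ∣ B ∣        ≤⟨ +-monoˡ-≤ ∣ B ∣ (rank-adjoin-≤ A∨x (atoms a a∈B) A′∨x′) ⟩
      suc (r x) + ∣ B ∣   ∎)
      where
      open ≤-Reasoning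
      ∣A′∣≡1+∣A∣ : ∣ A ∪ ⁅ a ⁆ ∣ ≡ suc ∣ A ∣
      ∣A′∣≡1+∣A∣ = ∣p∪⁅x⁆∣≡1+∣p∣ a∉A
      B≤k+A′ : ∣ B ∣ ≤ k + ∣ A ∪ ⁅ a ⁆ ∣
      B≤k+A′ = ≤-trans B≤k+A (≤-reflexive (≡.trans (≡.sym (+-suc k ∣ A ∣)) (≡.cong (k +_) (≡.sym ∣A′∣≡1+∣A∣))))

  rank-join≤∣∣ : ∀ {B y} → AtomSet B → JoinOf B y → r y ≤ ∣ B ∣
  rank-join≤∣∣ {B} {y} atoms B∨y = begin
    r y                  ≡⟨ ≡.sym (+-identityʳ (r y)) ⟩
    r y + 0              ≡⟨ ≡.cong (r y +_) (≡.sym (∣⊥∣≡0 m)) ⟩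
    r y + ∣ ⊥ {n = m} ∣  ≤⟨ rank-join-⊆ (⊆-min B) atoms join-⊥ B∨y ⟩
    r 0̂ + ∣ B ∣          ≡⟨ ≡.cong (_+ ∣ B ∣) rank-0̂ ⟩
    ∣ B ∣                ∎
    where open ≤-Reasoning

  Basis : Fin m → Subset m → Set ℓo
  Basis x U = AtomSet U × JoinOf U x × r x ≡ ∣ U ∣

  basis? : ∀ x U → Dec (Basis x U)
  basis? x U = atomSet? U ×-dec joinOf? U x ×-dec r x Nat.≟ ∣ U ∣

  basis-unique : ∀ {x y U} → Basis x U → Basis y U → x ≡ y
  basis-unique (_ , U∨x , _) (_ , U∨y , _) = join-unique U∨x U∨y

  ∄join⇒¬basis : ∀ {U} → ¬ ∃ (JoinOf U) → ∀ z → ¬ Basis z U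
  ∄join⇒¬basis ∄join z (_ , U∨z , _) = ∄join (z , U∨z)

  rank≢⇒¬basis : ∀ {U z} → JoinOf U z → r z ≢ ∣ U ∣ → ∀ z′ → ¬ Basis z′ U
  rank≢⇒¬basis U∨z r[z]≢∣U∣ z′ (_ , U∨z′ , r[z′]≡∣U∣) =
    r[z]≢∣U∣ (≡.trans (≡.cong r (join-unique U∨z U∨z′)) r[z′]≡∣U∣)

  basis-⊆ : ∀ {y A B} → Basis y B → A ⊆ B → ∃ λ x → Basis x A
  basis-⊆ {y} {A} {B} (atoms , B∨y , r[y]≡∣B∣) A⊆B with join-exists (λ u u∈A → proj₁ B∨y u (A⊆B u∈A))
  ... | x , A∨x = x , A-atoms , A∨x , ≤-antisym (rank-join≤∣∣ A-atoms A∨x) ∣A∣≤r[x]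
    where
    open ≤-Reasoning
    A-atoms : AtomSet A
    A-atoms u u∈A = atoms u (A⊆B u∈A)
    ∣A∣≤r[x] : ∣ A ∣ ≤ r x
    ∣A∣≤r[x] = +-cancelʳ-≤ ∣ B ∣ ∣ A ∣ (r x) (begin
      ∣ A ∣ + ∣ B ∣  ≡⟨ +-comm ∣ A ∣ ∣ B ∣ ⟩
      ∣ B ∣ + ∣ A ∣  ≡⟨ ≡.cong (_+ ∣ A ∣) (≡.sym r[y]≡∣B∣) ⟩
      r y + ∣ A ∣    ≤⟨ rank-join-⊆ A⊆B atoms A∨x B∨y ⟩
      r x + ∣ B ∣    ∎)

  basis-avoid : ∀ {x z U S a} → Basis x U → S ⊆ U → Basis z S → a ∈ U → a ∉ S → ¬ (a ≼ z)
  basis-avoid {z = z} {S = S} {a} U-basis S⊆U (_ , S∨z , r[z]≡∣S∣) a∈U a∉S a≼z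
    with basis-⊆ U-basis (∪⁅⁆⊆ S⊆U a∈U)
  ... | z′ , _ , S+a∨z′ , r[z′]≡∣S+a∣ = <⇒≢ (n<1+n ∣ S ∣) (begin
    ∣ S ∣            ≡⟨ ≡.sym r[z]≡∣S∣ ⟩
    r z              ≡⟨ ≡.cong r (join-unique (join-∪-absorb S∨z (∀∈-⁅⁆ a≼z)) S+a∨z′) ⟩
    r z′             ≡⟨ r[z′]≡∣S+a∣ ⟩
    ∣ S ∪ ⁅ a ⁆ ∣    ≡⟨ ∣p∪⁅x⁆∣≡1+∣p∣ a∉S ⟩
    suc ∣ S ∣        ∎)
    where open ≡.≡-Reasoning

  basis-replace : ∀ {A S T x z} → A ∩ S ≡ ⊥ → Basis x (A ∪ S) → Basis z S → Basis z T →
                  A ∩ T ≡ ⊥ × Basis x (A ∪ T)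
  basis-replace {A} {S} {T} {x} {z} A∩S≡⊥ A∪S-basis S-basis (T-atoms , T∨z , r[z]≡∣T∣) =
    A∩T≡⊥ , ∀∈-∪⁺ (∀∈-∪⁻ˡ A∪S-atoms) T-atoms , join-∪-replace S∨z T∨z A∪S∨x , r[x]≡∣A∪T∣
    where
    open ≡.≡-Reasoning
    A∪S-atoms = proj₁ A∪S-basis
    A∪S∨x = proj₁ (proj₂ A∪S-basis)
    S∨z = proj₁ (proj₂ S-basis)
    A∩T≡⊥ : A ∩ T ≡ ⊥
    A∩T≡⊥ = ∩≡⊥⁺ λ a∈A a∈T →
      basis-avoid A∪S-basis (q⊆p∪q A S) S-basis (x∈p∪q⁺ (inj₁ a∈A)) (∩≡⊥⁻ A∩S≡⊥ a∈A) (proj₁ T∨z _ a∈T)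
    r[x]≡∣A∪T∣ : r x ≡ ∣ A ∪ T ∣
    r[x]≡∣A∪T∣ = begin
      r x            ≡⟨ proj₂ (proj₂ A∪S-basis) ⟩
      ∣ A ∪ S ∣      ≡⟨ ∣p∪q∣≡∣p∣+∣q∣ A S A∩S≡⊥ ⟩
      ∣ A ∣ + ∣ S ∣  ≡⟨ ≡.cong (∣ A ∣ +_) (≡.trans (≡.sym (proj₂ (proj₂ S-basis))) r[z]≡∣T∣) ⟩
      ∣ A ∣ + ∣ T ∣  ≡⟨ ≡.sym (∣p∪q∣≡∣p∣+∣q∣ A T A∩T≡⊥) ⟩
      ∣ A ∪ T ∣      ∎

  basis-adjoin : ∀ {T t a t′} → Basis t T → Atom a → ¬ (a ≼ t) → JoinOf (T ∪ ⁅ a ⁆) t′ →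
                 Basis t′ (T ∪ ⁅ a ⁆)
  basis-adjoin {T} {t} {a} {t′} (atoms , T∨t , r[t]≡∣T∣) 0̂⋖a a⋠t T+a∨t′ =
    ∀∈-∪⁺ atoms (∀∈-⁅⁆ 0̂⋖a) , T+a∨t′ , (begin
      r t′           ≡⟨ ≤-antisym (rank-adjoin-≤ T∨t 0̂⋖a T+a∨t′) (rank-strictMono (t≼t′ , t≢t′)) ⟩
      suc (r t)      ≡⟨ ≡.cong suc r[t]≡∣T∣ ⟩
      suc ∣ T ∣      ≡⟨ ≡.sym (∣p∪⁅x⁆∣≡1+∣p∣ (λ a∈T → a⋠t (proj₁ T∨t a a∈T))) ⟩
      ∣ T ∪ ⁅ a ⁆ ∣  ∎)
    where
    open ≡.≡-Reasoning
    a≼t′ : a ≼ t′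
    a≼t′ = ∀∈-∪⁻ʳ (proj₁ T+a∨t′) a (x∈⁅x⁆ a)
    t≼t′ : t ≼ t′
    t≼t′ = join-mono (p⊆p∪q ⁅ a ⁆) T∨t T+a∨t′
    t≢t′ : t ≢ t′
    t≢t′ t≡t′ = a⋠t (≡.subst (a ≼_) (≡.sym t≡t′) a≼t′)

  module _ {S x} (S-atoms : AtomSet S) (S∨x : JoinOf S x) where

    record PartialBasis (xs : List (Fin m)) : Set ℓo where
      field
        U       : Subset m
        u       : Fin m
        U⊆S     : U ⊆ S
        U-basis : Basis u U
        covers  : ∀ {a} → a ∈ S → a ∈ₗ xs → a ≼ u

    private
      keep : ∀ {a xs} (g : PartialBasis xs) → (a ∈ S → a ≼ PartialBasis.u g) → PartialBasis (a ∷ xs)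
      keep g a≼u = record
        { U = U ; u = u ; U⊆S = U⊆S ; U-basis = U-basis
        ; covers = λ { a∈S (here ≡.refl) → a≼u a∈S ; b∈S (there b∈xs) → covers b∈S b∈xs } }
        where open PartialBasis g

      extend : ∀ {a xs} (g : PartialBasis xs) → a ∈ S → ¬ (a ≼ PartialBasis.u g) → PartialBasis (a ∷ xs)
      extend {a} g a∈S a⋠u = record
        { U = U ∪ ⁅ a ⁆ ; u = proj₁ U+a-join ; U⊆S = ∪⁅⁆⊆ U⊆S a∈S
        ; U-basis = basis-adjoin U-basis (S-atoms a a∈S) a⋠u (proj₂ U+a-join)
        ; covers = λ { _ (here ≡.refl) → ∀∈-∪⁻ʳ (proj₁ (proj₂ U+a-join)) a (x∈⁅x⁆ a)
                     ; b∈S (there b∈xs) → ≼-trans (covers b∈S b∈xs) u≼u′ } }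
        where
        open PartialBasis g
        U+a-join = join-exists (∀∈-∪⁺ (λ v v∈U → proj₁ S∨x v (U⊆S v∈U)) (∀∈-⁅⁆ (proj₁ S∨x a a∈S)))
        u≼u′ = join-mono (p⊆p∪q ⁅ a ⁆) (proj₁ (proj₂ U-basis)) (proj₂ U+a-join)

    greedy : ∀ xs → PartialBasis xs
    greedy [] = record
      { U = ⊥ ; u = 0̂ ; U⊆S = ⊆-min S
      ; U-basis = ∀∈-⊥ , join-⊥ , ≡.trans rank-0̂ (≡.sym (∣⊥∣≡0 m))
      ; covers = λ _ () }
    greedy (a ∷ xs) with greedy xs | a ∈? S
    ... | g | no a∉S  = keep g (λ a∈S → ⊥-elim (a∉S a∈S))
    ... | g | yes a∈S with a ≼? PartialBasis.u g
    ...   | yes a≼u = keep g (λ _ → a≼u)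
    ...   | no a⋠u  = extend g a∈S a⋠u

    basis-of-join : ∃ (Basis x)
    basis-of-join = U , ≡.subst (λ y → Basis y U) u≡x U-basis
      where
      open PartialBasis (greedy (allFin m))
      u≡x : u ≡ x
      u≡x = antisym (join-mono U⊆S (proj₁ (proj₂ U-basis)) S∨x) (proj₂ S∨x u λ a a∈S → covers a∈S (∈-allFin a))

  basis-exists : Atomic → ∀ x → ∃ (Basis x)
  basis-exists atomic x = let S , S-atoms , S∨x = atomic x in basis-of-join S-atoms S∨x

module ExteriorChar2
    {c ℓ ℓo : Level} (K : Field c ℓ) (char2 : Char2 K)
    (m : ℕ) (_≼_ : Rel (Fin m) ℓo) (0̂ : Fin m) (r : Fin m → ℕ) where

  open Field K
  open Exterior K m _≼_ 0̂ r
  open Poset.WithBottom m _≼_ 0̂ using (AtomSet)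
  open ListSum commutativeRing
  open import Algebra.Properties.Group +-group using (inverseʳ-unique)
  open import Algebra.Solver.CommutativeMonoid *-commutativeMonoid using (solve; _⊜_) renaming (_⊕_ to _⊗_)
  open import Algebra.Properties.CommutativeSemigroup *-commutativeSemigroup
    using (x∙yz≈y∙xz; xy∙z≈y∙xz; xy∙z≈xz∙y)
  open import Relation.Binary.Reasoning.Setoid setoid

  x+x≈0 : ∀ x → x + x ≈ 0#
  x+x≈0 x = begin
    x + x              ≈⟨ +-cong (sym (*-identityˡ x)) (sym (*-identityˡ x)) ⟩
    1# * x + 1# * x    ≈⟨ sym (distribʳ x 1# 1#) ⟩
    (1# + 1#) * x      ≈⟨ *-congʳ char2 ⟩
    0# * x             ≈⟨ zeroˡ x ⟩
    0#                 ∎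

  -x≈x : ∀ x → - x ≈ x
  -x≈x x = sym (inverseʳ-unique x x (x+x≈0 x))

  sign≈1 : ∀ k → sign k ≈ 1#
  sign≈1 zero    = refl
  sign≈1 (suc k) = trans (-x≈x (sign k)) (sign≈1 k)

  ⊖≐⊕ : ∀ v w → (v ⊖ w) ≐ (v ⊕ w)
  ⊖≐⊕ v w U = +-congˡ (-x≈x (w U))

  𝒫 : List (Subset m)
  𝒫 = allSubsets m

  -- e S U unfolds to ⟦ ⌊ S ≟S U ⌋ ⟧, the Iverson bracket of ListSum.
  ∑-e : ∀ S (f : Subset m → Carrier) → ∑[ U ← 𝒫 ] (e S U * f U) ≈ f S
  ∑-e S f = ∑-δ _≟S_ f (allSubsets-unique m) (allSubsets-complete S)

  e-comm : ∀ S U → e S U ≡ e U S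
  e-comm S U = ≡.cong ⟦_⟧ (⌊≟⌋-sym _≟S_ S U)

  e-off : ∀ {S U} → S ≢ U → e S U ≈ 0#
  e-off {S} {U} S≢U = reflexive (≡.cong ⟦_⟧ (⌊⌋-no (S ≟S U) S≢U))

  e-homogeneous : ∀ {S} → AtomSet S → InDeg ∣ S ∣ (e S)
  e-homogeneous {S} atoms = (λ U ¬atoms → e-off λ S≡U → ¬atoms (≡.subst AtomSet S≡U atoms)) ,
                            (λ U ∣U∣≢∣S∣ → e-off λ S≡U → ∣U∣≢∣S∣ (≡.cong ∣_∣ (≡.sym S≡U)))

  coef≈ : ∀ R S U → coef R S U ≈ ⟦ disjoint? R S ∧ ⌊ (R ∪ S) ≟S U ⌋ ⟧
  coef≈ R S U with disjoint? R S ∧ ⌊ (R ∪ S) ≟S U ⌋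
  ... | true  = sign≈1 (inv R S)
  ... | false = refl

  ⟨_,_⟩ : (Subset m → Carrier) → Elt → Carrier
  ⟨ ω , v ⟩ = ∑[ U ← 𝒫 ] (ω U * v U)

  -- Interior product by e_R: ⟨ ω , e_R ∧ w ⟩ = ⟨ R ⌟ ω , w ⟩.
  _⌟_ : Subset m → (Subset m → Carrier) → Subset m → Carrier
  (R ⌟ ω) S = ⟦ disjoint? R S ⟧ * ω (R ∪ S)

  ⟨⟩-congˡ : ∀ {ω ω′} v → (∀ U → ω U ≈ ω′ U) → ⟨ ω , v ⟩ ≈ ⟨ ω′ , v ⟩
  ⟨⟩-congˡ v ω≈ω′ = ∑-cong 𝒫 λ U → *-congʳ (ω≈ω′ U)

  ⟨⟩-congʳ : ∀ ω {v w} → v ≐ w → ⟨ ω , v ⟩ ≈ ⟨ ω , w ⟩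
  ⟨⟩-congʳ ω v≐w = ∑-cong 𝒫 λ U → *-congˡ (v≐w U)

  ⟨⟩-⊕ : ∀ ω v w → ⟨ ω , v ⊕ w ⟩ ≈ ⟨ ω , v ⟩ + ⟨ ω , w ⟩
  ⟨⟩-⊕ ω v w = trans (∑-cong 𝒫 λ U → distribˡ (ω U) (v U) (w U)) (∑-+ 𝒫 _ _)

  ⟨e,⟩ : ∀ W v → ⟨ e W , v ⟩ ≈ v W
  ⟨e,⟩ W v = ∑-e W v

  ⟨,e⟩ : ∀ ω S → ⟨ ω , e S ⟩ ≈ ω S
  ⟨,e⟩ ω S = trans (∑-cong 𝒫 λ U → *-comm (ω U) (e S U)) (∑-e S ω)

  ⟨⟩-⋏ : ∀ ω v w → ⟨ ω , v ⋏ w ⟩ ≈ ∑[ R ← 𝒫 ] (v R * ⟨ R ⌟ ω , w ⟩)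
  ⟨⟩-⋏ ω v w = begin
    ∑[ U ← 𝒫 ] (ω U * ∑[ R ← 𝒫 ] ∑[ S ← 𝒫 ] (coef R S U * (v R * w S)))
      ≈⟨ ∑-cong 𝒫 (λ U → trans (∑-*ˡ 𝒫 (ω U) _) (∑-cong 𝒫 λ R → ∑-*ˡ 𝒫 (ω U) _)) ⟩
    ∑[ U ← 𝒫 ] ∑[ R ← 𝒫 ] ∑[ S ← 𝒫 ] (ω U * (coef R S U * (v R * w S)))
      ≈⟨ trans (∑-comm 𝒫 𝒫 _) (∑-cong 𝒫 λ R → ∑-comm 𝒫 𝒫 _) ⟩
    ∑[ R ← 𝒫 ] ∑[ S ← 𝒫 ] ∑[ U ← 𝒫 ] (ω U * (coef R S U * (v R * w S)))
      ≈⟨ ∑-cong 𝒫 (λ R → ∑-cong 𝒫 λ S → ∑-cong 𝒫 λ U → regroup R S U) ⟩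
    ∑[ R ← 𝒫 ] ∑[ S ← 𝒫 ] ∑[ U ← 𝒫 ] (e (R ∪ S) U * (v R * ((⟦ disjoint? R S ⟧ * ω U) * w S)))
      ≈⟨ ∑-cong 𝒫 (λ R → ∑-cong 𝒫 λ S → ∑-e (R ∪ S) _) ⟩
    ∑[ R ← 𝒫 ] ∑[ S ← 𝒫 ] (v R * ((R ⌟ ω) S * w S))
      ≈⟨ ∑-cong 𝒫 (λ R → sym (∑-*ˡ 𝒫 (v R) _)) ⟩
    ∑[ R ← 𝒫 ] (v R * ⟨ R ⌟ ω , w ⟩) ∎
    where
    regroup : ∀ R S U → ω U * (coef R S U * (v R * w S)) ≈
                        e (R ∪ S) U * (v R * ((⟦ disjoint? R S ⟧ * ω U) * w S))
    regroup R S U = trans (*-congˡ (*-congʳ (trans (coef≈ R S U) (⟦∧⟧ (disjoint? R S) _))))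
      (solve 5 (λ a b c d f → a ⊗ ((b ⊗ c) ⊗ (d ⊗ f)) ⊜ c ⊗ (d ⊗ ((b ⊗ a) ⊗ f))) refl
             (ω U) ⟦ disjoint? R S ⟧ (e (R ∪ S) U) (v R) (w S))

  expansion : ∀ v W → ∑[ U ← 𝒫 ] (v U * e U W) ≈ v W
  expansion v W = trans (∑-cong 𝒫 λ U → trans (*-comm (v U) (e U W)) (reflexive (≡.cong (_* v U) (e-comm U W))))
                        (⟨e,⟩ W v)

  ⌟-⊥ʳ : ∀ R ω → (R ⌟ ω) ⊥ ≈ ω R
  ⌟-⊥ʳ R ω = begin
    ⟦ disjoint? R ⊥ ⟧ * ω (R ∪ ⊥)
      ≡⟨ ≡.cong₂ (λ b S → ⟦ b ⟧ * ω S) (⌊⌋-yes ((R ∩ ⊥) ≟S ⊥) (∩-zeroʳ R)) (∪-identityʳ R) ⟩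
    1# * ω R                       ≈⟨ *-identityˡ (ω R) ⟩
    ω R                            ∎

  ⌟-⊥ˡ : ∀ ω S → (⊥ ⌟ ω) S ≈ ω S
  ⌟-⊥ˡ ω S = begin
    ⟦ disjoint? ⊥ S ⟧ * ω (⊥ ∪ S)
      ≡⟨ ≡.cong₂ (λ b S → ⟦ b ⟧ * ω S) (⌊⌋-yes ((⊥ ∩ S) ≟S ⊥) (∩-zeroˡ S)) (∪-identityˡ S) ⟩
    1# * ω S                       ≈⟨ *-identityˡ (ω S) ⟩
    ω S                            ∎

  ⋏-e⊥ : ∀ v → (v ⋏ e ⊥) ≐ v
  ⋏-e⊥ v W = begin
    (v ⋏ e ⊥) W                       ≈⟨ sym (⟨e,⟩ W (v ⋏ e ⊥)) ⟩
    ⟨ e W , v ⋏ e ⊥ ⟩                 ≈⟨ ⟨⟩-⋏ (e W) v (e ⊥) ⟩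
    ∑[ R ← 𝒫 ] (v R * ⟨ R ⌟ e W , e ⊥ ⟩)
      ≈⟨ ∑-cong 𝒫 (λ R → *-congˡ (trans (⟨,e⟩ (R ⌟ e W) ⊥) (⌟-⊥ʳ R (e W)))) ⟩
    ∑[ R ← 𝒫 ] (v R * e W R)          ≈⟨ ∑-cong 𝒫 (λ R → *-comm (v R) (e W R)) ⟩
    ⟨ e W , v ⟩                       ≈⟨ ⟨e,⟩ W v ⟩
    v W                               ∎

  e⊥-⋏ : ∀ k g → ((k ⊙ e ⊥) ⋏ g) ≐ (k ⊙ g)
  e⊥-⋏ k g W = begin
    ((k ⊙ e ⊥) ⋏ g) W                          ≈⟨ sym (⟨e,⟩ W ((k ⊙ e ⊥) ⋏ g)) ⟩
    ⟨ e W , (k ⊙ e ⊥) ⋏ g ⟩                    ≈⟨ ⟨⟩-⋏ (e W) (k ⊙ e ⊥) g ⟩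
    ∑[ R ← 𝒫 ] ((k * e ⊥ R) * ⟨ R ⌟ e W , g ⟩)  ≈⟨ ∑-cong 𝒫 (λ R → xy∙z≈y∙xz k (e ⊥ R) _) ⟩
    ∑[ R ← 𝒫 ] (e ⊥ R * (k * ⟨ R ⌟ e W , g ⟩))  ≈⟨ ∑-e ⊥ _ ⟩
    k * ⟨ ⊥ ⌟ e W , g ⟩                        ≈⟨ *-congˡ (⟨⟩-congˡ g (⌟-⊥ˡ (e W))) ⟩
    k * ⟨ e W , g ⟩                            ≈⟨ *-congˡ (⟨e,⟩ W g) ⟩
    k * g W                                    ∎

  ⌟-⌟ : ∀ ω R T S → (R ⌟ (λ A → (A ⌟ ω) T)) S ≈ ⟦ disjoint? R T ⟧ * ((R ∪ T) ⌟ ω) S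
  ⌟-⌟ ω R T S = begin
    ⟦ disjoint? R S ⟧ * (⟦ disjoint? (R ∪ S) T ⟧ * ω ((R ∪ S) ∪ T))
      ≈⟨ sym (*-assoc _ _ _) ⟩
    (⟦ disjoint? R S ⟧ * ⟦ disjoint? (R ∪ S) T ⟧) * ω ((R ∪ S) ∪ T)
      ≈⟨ *-congʳ (sym (⟦∧⟧ (disjoint? R S) _)) ⟩
    ⟦ disjoint? R S ∧ disjoint? (R ∪ S) T ⟧ * ω ((R ∪ S) ∪ T)
      ≡⟨ ≡.cong₂ (λ b U → ⟦ b ⟧ * ω U) (disjoint?-swap R S T) (∪-swap R S T) ⟩
    ⟦ disjoint? R T ∧ disjoint? (R ∪ T) S ⟧ * ω ((R ∪ T) ∪ S)
      ≈⟨ *-congʳ (⟦∧⟧ (disjoint? R T) _) ⟩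
    (⟦ disjoint? R T ⟧ * ⟦ disjoint? (R ∪ T) S ⟧) * ω ((R ∪ T) ∪ S)
      ≈⟨ *-assoc _ _ _ ⟩
    ⟦ disjoint? R T ⟧ * ((R ∪ T) ⌟ ω) S ∎
    where
    ∪-swap : ∀ R S T → (R ∪ S) ∪ T ≡ (R ∪ T) ∪ S
    ∪-swap R S T = ≡.trans (∪-assoc R S T) (≡.trans (≡.cong (R ∪_) (∪-comm S T)) (≡.sym (∪-assoc R T S)))

  ⌟-⟨⌟⟩ : ∀ ω q R S → (R ⌟ (λ A → ⟨ A ⌟ ω , q ⟩)) S ≈ ∑[ T ← 𝒫 ] ((⟦ disjoint? R T ⟧ * q T) * ((R ∪ T) ⌟ ω) S)
  ⌟-⟨⌟⟩ ω q R S = begin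
    ⟦ disjoint? R S ⟧ * ∑[ T ← 𝒫 ] (((R ∪ S) ⌟ ω) T * q T)
      ≈⟨ ∑-*ˡ 𝒫 _ _ ⟩
    ∑[ T ← 𝒫 ] (⟦ disjoint? R S ⟧ * (((R ∪ S) ⌟ ω) T * q T))
      ≈⟨ ∑-cong 𝒫 (λ T → sym (*-assoc _ _ _)) ⟩
    ∑[ T ← 𝒫 ] ((R ⌟ (λ A → (A ⌟ ω) T)) S * q T)
      ≈⟨ ∑-cong 𝒫 (λ T → *-congʳ (⌟-⌟ ω R T S)) ⟩
    ∑[ T ← 𝒫 ] ((⟦ disjoint? R T ⟧ * ((R ∪ T) ⌟ ω) S) * q T)
      ≈⟨ ∑-cong 𝒫 (λ T → xy∙z≈xz∙y _ _ _) ⟩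
    ∑[ T ← 𝒫 ] ((⟦ disjoint? R T ⟧ * q T) * ((R ∪ T) ⌟ ω) S) ∎

  ⟨⟩-⋏⋏ : ∀ ω p g q → ⟨ ω , (p ⋏ g) ⋏ q ⟩ ≈ ∑[ R ← 𝒫 ] (p R * ⟨ R ⌟ (λ A → ⟨ A ⌟ ω , q ⟩) , g ⟩)
  ⟨⟩-⋏⋏ ω p g q = begin
    ⟨ ω , (p ⋏ g) ⋏ q ⟩                          ≈⟨ ⟨⟩-⋏ ω (p ⋏ g) q ⟩
    ∑[ A ← 𝒫 ] ((p ⋏ g) A * ⟨ A ⌟ ω , q ⟩)       ≈⟨ ∑-cong 𝒫 (λ A → *-comm _ _) ⟩
    ⟨ (λ A → ⟨ A ⌟ ω , q ⟩) , p ⋏ g ⟩           ≈⟨ ⟨⟩-⋏ _ p g ⟩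
    ∑[ R ← 𝒫 ] (p R * ⟨ R ⌟ (λ A → ⟨ A ⌟ ω , q ⟩) , g ⟩) ∎

  Term : Set c
  Term = Elt × Elt × Elt

  term : Term → Elt
  term (x , g , y) = (x ⋏ g) ⋏ y

  Good : Term → Set (ℓ ⊔ ℓo)
  Good (x , g , y) = ExtElt x × IsGen g × ExtElt y

  -- InIdeal v unfolds to ∃ λ ts → All Good ts × (v ≐ sumTerms ts).
  sumTerms : List Term → Elt
  sumTerms = foldr (λ t acc → term t ⊕ acc) zeroE

  sumTerms-++ : ∀ ts us → sumTerms (ts ++ us) ≐ (sumTerms ts ⊕ sumTerms us)
  sumTerms-++ []       us U = sym (+-identityˡ _)
  sumTerms-++ (t ∷ ts) us U = trans (+-congˡ (sumTerms-++ ts us U)) (sym (+-assoc _ _ _))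

  InIdeal-resp : ∀ {v w} → v ≐ w → InIdeal v → InIdeal w
  InIdeal-resp v≐w (ts , good , v≐ts) = ts , good , λ U → trans (sym (v≐w U)) (v≐ts U)

  InIdeal-zero : ∀ {v} → v ≐ zeroE → InIdeal v
  InIdeal-zero v≐0 = [] , [] , v≐0

  InIdeal-⊕ : ∀ {v w} → InIdeal v → InIdeal w → InIdeal (v ⊕ w)
  InIdeal-⊕ (ts , ts-good , v≐ts) (us , us-good , w≐us) =
    ts ++ us , All.++⁺ ts-good us-good , λ U → trans (+-cong (v≐ts U) (w≐us U)) (sym (sumTerms-++ ts us U))

  e⊥-ext : ExtElt (e ⊥)
  e⊥-ext = proj₁ (e-homogeneous ∀∈-⊥)

  InIdeal-gen : ∀ k {v g} → IsGen g → v ≐ g → InIdeal (k ⊙ v)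
  InIdeal-gen k {v} {g} isGen v≐g = (k ⊙ e ⊥ , g , e ⊥) ∷ [] , (k⊙e⊥-ext , isGen , e⊥-ext) ∷ [] , λ U → begin
    k * v U                               ≈⟨ *-congˡ (v≐g U) ⟩
    k * g U                               ≈⟨ sym (e⊥-⋏ k g U) ⟩
    ((k ⊙ e ⊥) ⋏ g) U                     ≈⟨ sym (⋏-e⊥ ((k ⊙ e ⊥) ⋏ g) U) ⟩
    term (k ⊙ e ⊥ , g , e ⊥) U            ≈⟨ sym (+-identityʳ _) ⟩
    term (k ⊙ e ⊥ , g , e ⊥) U + 0#       ∎
    where
    k⊙e⊥-ext : ExtElt (k ⊙ e ⊥)
    k⊙e⊥-ext U ¬atoms = trans (*-congˡ (e⊥-ext U ¬atoms)) (zeroʳ k)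

  ⨁ : ∀ {a} {A : Set a} → List A → (A → Elt) → Elt
  ⨁ xs f = foldr (λ x acc → f x ⊕ acc) zeroE xs

  ⨁-apply : ∀ {a} {A : Set a} xs (f : A → Elt) W → ⨁ xs f W ≡ ∑[ x ← xs ] f x W
  ⨁-apply []       f W = ≡.refl
  ⨁-apply (x ∷ xs) f W = ≡.cong (f x W +_) (⨁-apply xs f W)

  InIdeal-⨁ : ∀ {a} {A : Set a} xs (f : A → Elt) → (∀ x → InIdeal (f x)) → InIdeal (⨁ xs f)
  InIdeal-⨁ []       f f∈I = InIdeal-zero λ _ → refl
  InIdeal-⨁ (x ∷ xs) f f∈I = InIdeal-⊕ (f∈I x) (InIdeal-⨁ xs f f∈I)

  ⟨⟩-⊙ : ∀ ω k v → ⟨ ω , k ⊙ v ⟩ ≈ k * ⟨ ω , v ⟩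
  ⟨⟩-⊙ ω k v = trans (∑-cong 𝒫 λ U → x∙yz≈y∙xz (ω U) k (v U)) (sym (∑-*ˡ 𝒫 k _))

  ⟨⟩-⨁ : ∀ ω {a} {A : Set a} xs (f : A → Elt) → ⟨ ω , ⨁ xs f ⟩ ≈ ∑[ x ← xs ] ⟨ ω , f x ⟩
  ⟨⟩-⨁ ω []       f = ∑-zero (universal (λ U → zeroʳ (ω U)) 𝒫)
  ⟨⟩-⨁ ω (x ∷ xs) f = trans (⟨⟩-⊕ ω (f x) (⨁ xs f)) (+-congˡ (⟨⟩-⨁ ω xs f))

  ⟨⟩-lincomb : ∀ ω {d} (b : Fin d → Elt) a → ⟨ ω , lincomb b a ⟩ ≈ ∑[ k ← allFin d ] (a k * ⟨ ω , b k ⟩)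
  ⟨⟩-lincomb ω {d} b a = trans (⟨⟩-⨁ ω (allFin d) (λ k → a k ⊙ b k)) (∑-cong (allFin d) λ k → ⟨⟩-⊙ ω (a k) (b k))

  lincomb-apply : ∀ {d} (b : Fin d → Elt) a W → lincomb b a W ≡ ∑[ k ← allFin d ] (a k * b k W)
  lincomb-apply {d} b a = ⨁-apply (allFin d) (λ k → a k ⊙ b k)

module Char2Quotient
    {c ℓ ℓo : Level} (K : Field c ℓ) (char2 : Char2 K)
    (m : ℕ) (_≼_ : Rel (Fin m) ℓo) (_⊓_ : Fin m → Fin m → Fin m)
    (isMeetSemilattice : IsMeetSemilattice _≡_ _≼_ _⊓_)
    (0̂ : Fin m) (0̂-minimum : Minimum _≼_ 0̂)
    (r : Fin m → ℕ) (isRank : Poset.WithBottom.IsRank m _≼_ 0̂ r)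
    (geometric : Poset.WithBottom.Geometric m _≼_ 0̂ _⊓_ r) where

  open Field K
  open Poset m _≼_
  open WithBottom 0̂
  open Exterior K m _≼_ 0̂ r
  open ListSum commutativeRing
  open GeometricSemilattice m _≼_ _⊓_ isMeetSemilattice 0̂ 0̂-minimum r isRank geometric
  open ExteriorChar2 K char2 m _≼_ 0̂ r
  open import Algebra.Properties.CommutativeSemigroup *-commutativeSemigroup using (x∙yz≈yx∙z)
  open import Relation.Binary.Reasoning.Setoid setoid

  χ : Fin m → Subset m → Carrier
  χ x U = ⟦ ⌊ basis? x U ⌋ ⟧

  record FlatInvariant (ω : Subset m → Carrier) : Set (ℓ ⊔ ℓo) where
    field
      dependent : ∀ S → (∀ z → ¬ Basis z S) → ω S ≈ 0#
      balanced  : ∀ {S T z} → Basis z S → Basis z T → ω S ≈ ω T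

  open FlatInvariant

  flatInvariant-⟨e⟩ : ∀ {ω g S} → FlatInvariant ω → g ≐ e S → (∀ z → ¬ Basis z S) → ⟨ ω , g ⟩ ≈ 0#
  flatInvariant-⟨e⟩ {ω} {S = S} adm g≐eS ∄basis =
    trans (⟨⟩-congʳ ω g≐eS) (trans (⟨,e⟩ ω S) (dependent adm S ∄basis))

  flatInvariant-⟨gen⟩ : ∀ {ω g} → FlatInvariant ω → IsGen g → ⟨ ω , g ⟩ ≈ 0#
  flatInvariant-⟨gen⟩ adm (inj₁ (S , _ , ∄join , g≐eS)) =
    flatInvariant-⟨e⟩ adm g≐eS (∄join⇒¬basis ∄join)
  flatInvariant-⟨gen⟩ adm (inj₂ (inj₁ (S , z , _ , S∨z , r[z]≢∣S∣ , g≐eS))) =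
    flatInvariant-⟨e⟩ adm g≐eS (rank≢⇒¬basis S∨z r[z]≢∣S∣)
  flatInvariant-⟨gen⟩ {ω} {g} adm
    (inj₂ (inj₂ (S , T , z , _ , S-atoms , T-atoms , S∨z , T∨z , r[z]≡∣S∣ , r[z]≡∣T∣ , g≐eS⊖eT))) = begin
    ⟨ ω , g ⟩                  ≈⟨ ⟨⟩-congʳ ω (λ U → trans (g≐eS⊖eT U) (⊖≐⊕ (e S) (e T) U)) ⟩
    ⟨ ω , e S ⊕ e T ⟩          ≈⟨ ⟨⟩-⊕ ω (e S) (e T) ⟩
    ⟨ ω , e S ⟩ + ⟨ ω , e T ⟩  ≈⟨ +-cong (⟨,e⟩ ω S) (⟨,e⟩ ω T) ⟩
    ω S + ω T                  ≈⟨ +-congʳ (balanced adm (S-atoms , S∨z , r[z]≡∣S∣) (T-atoms , T∨z , r[z]≡∣T∣)) ⟩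
    ω T + ω T                  ≈⟨ x+x≈0 (ω T) ⟩
    0#                         ∎

  flatInvariant-resp : ∀ {ω ω′} → (∀ S → ω S ≈ ω′ S) → FlatInvariant ω → FlatInvariant ω′
  flatInvariant-resp ω≈ω′ adm = record
    { dependent = λ S ∄basis → trans (sym (ω≈ω′ S)) (dependent adm S ∄basis)
    ; balanced  = λ S-basis T-basis → trans (sym (ω≈ω′ _)) (trans (balanced adm S-basis T-basis) (ω≈ω′ _)) }

  flatInvariant-∑ : ∀ {a} {A : Set a} xs (k : A → Carrier) {ω : A → Subset m → Carrier} →
                 (∀ x → FlatInvariant (ω x)) → FlatInvariant (λ S → ∑[ x ← xs ] (k x * ω x S))
  flatInvariant-∑ xs k adm = record
    { dependent = λ S ∄basis →
        ∑-zero (universal (λ x → trans (*-congˡ (dependent (adm x) S ∄basis)) (zeroʳ (k x))) xs)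
    ; balanced  = λ S-basis T-basis → ∑-cong xs λ x → *-congˡ (balanced (adm x) S-basis T-basis) }

  -- (A ⌟ χ x) S is the indicator of "A ∩ S = ∅ and A ∪ S is a basis of x"; basis-replace does the rest.
  flatInvariant-⌟ : ∀ x A → FlatInvariant (A ⌟ χ x)
  flatInvariant-⌟ x A = flatInvariant-resp (λ S → ⟦∧⟧ (disjoint? A S) _) record
    { dependent = λ S ∄basis → ⟦⟧-false λ extends →
        let _ , A∪S-basis = unpack extends in ∄basis _ (proj₂ (basis-⊆ A∪S-basis (q⊆p∪q A S)))
    ; balanced  = λ S-basis T-basis →
        reflexive (≡.cong ⟦_⟧ (T-injective (exchange S-basis T-basis) (exchange T-basis S-basis))) }
    where
    extends? : Subset m → Bool
    extends? S = disjoint? A S ∧ ⌊ basis? x (A ∪ S) ⌋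
    unpack : ∀ {S} → T (extends? S) → A ∩ S ≡ ⊥ × Basis x (A ∪ S)
    unpack {S} t = let t₁ , t₂ = Equivalence.to (T-∧ {disjoint? A S}) t
                   in toWitness {a? = (A ∩ S) ≟S ⊥} t₁ , toWitness {a? = basis? x (A ∪ S)} t₂
    pack : ∀ {S} → A ∩ S ≡ ⊥ → Basis x (A ∪ S) → T (extends? S)
    pack {S} A∩S≡⊥ A∪S-basis =
      Equivalence.from (T-∧ {disjoint? A S}) (fromWitness A∩S≡⊥ , fromWitness {a? = basis? x (A ∪ S)} A∪S-basis)
    exchange : ∀ {S S′ z} → Basis z S → Basis z S′ → T (extends? S) → T (extends? S′)
    exchange S-basis S′-basis extends = let A∩S≡⊥ , A∪S-basis = unpack extends
                                            A∩S′≡⊥ , A∪S′-basis = basis-replace A∩S≡⊥ A∪S-basis S-basis S′-basis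
                                        in pack A∩S′≡⊥ A∪S′-basis

  ⟨χ,term⟩ : ∀ x {t} → Good t → ⟨ χ x , term t ⟩ ≈ 0#
  ⟨χ,term⟩ x {p , g , q} (_ , isGen , _) = begin
    ⟨ χ x , (p ⋏ g) ⋏ q ⟩                                   ≈⟨ ⟨⟩-⋏⋏ (χ x) p g q ⟩
    ∑[ R ← 𝒫 ] (p R * ⟨ R ⌟ (λ A → ⟨ A ⌟ χ x , q ⟩) , g ⟩)  ≈⟨ ∑-zero (universal (λ R → p[R]*0≈0 R) 𝒫) ⟩
    0#                                                      ∎
    where
    p[R]*0≈0 : ∀ R → p R * ⟨ R ⌟ (λ A → ⟨ A ⌟ χ x , q ⟩) , g ⟩ ≈ 0#
    p[R]*0≈0 R = trans (*-congˡ (flatInvariant-⟨gen⟩ flatInvariant isGen)) (zeroʳ (p R))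
      where
      flatInvariant = flatInvariant-resp (λ S → sym (⌟-⟨⌟⟩ (χ x) q R S))
                                   (flatInvariant-∑ 𝒫 _ λ T → flatInvariant-⌟ x (R ∪ T))

  ⟨χ,ideal⟩ : ∀ x {v} → InIdeal v → ⟨ χ x , v ⟩ ≈ 0#
  ⟨χ,ideal⟩ x (ts , good , v≐ts) = trans (⟨⟩-congʳ (χ x) v≐ts) (go good)
    where
    go : ∀ {ts} → All Good ts → ⟨ χ x , sumTerms ts ⟩ ≈ 0#
    go []             = ∑-zero (universal (λ U → zeroʳ (χ x U)) 𝒫)
    go {t ∷ ts} (t-good ∷ ts-good) = begin
      ⟨ χ x , term t ⊕ sumTerms ts ⟩             ≈⟨ ⟨⟩-⊕ (χ x) (term t) (sumTerms ts) ⟩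
      ⟨ χ x , term t ⟩ + ⟨ χ x , sumTerms ts ⟩   ≈⟨ +-cong (⟨χ,term⟩ x t-good) (go ts-good) ⟩
      0# + 0#                                    ≈⟨ +-identityˡ 0# ⟩
      0#                                         ∎

  module Degree (atomic : Atomic) (i : ℕ) where

    flats : List (Fin m)
    flats = filter (λ y → r y Nat.≟ i) (allFin m)

    d : ℕ
    d = length flats

    x : Fin d → Fin m
    x = lookup flats

    rank-x : ∀ j → r (x j) ≡ i
    rank-x j = proj₂ (∈-filter⁻ (λ y → r y Nat.≟ i) {xs = allFin m} (∈-lookup j))

    x-injective : ∀ {j k} → x j ≡ x k → j ≡ k
    x-injective = lookup-injective (Unique.filter⁺ (λ y → r y Nat.≟ i) (Unique.allFin⁺ m))

    x-surjective : ∀ {z} → r z ≡ i → ∃ λ j → x j ≡ z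
    x-surjective r[z]≡i = index z∈flats , ≡.sym (lookup-index z∈flats)
      where z∈flats = ∈-filter⁺ (λ y → r y Nat.≟ i) (∈-allFin _) r[z]≡i

    S : Fin d → Subset m
    S j = proj₁ (basis-exists atomic (x j))

    S-basis : ∀ j → Basis (x j) (S j)
    S-basis j = proj₂ (basis-exists atomic (x j))

    b : Fin d → Elt
    b j = e (S j)

    coord : Elt → Fin d → Carrier
    coord v j = ⟨ χ (x j) , v ⟩

    b-homogeneous : ∀ j → InDeg i (b j)
    b-homogeneous j = ≡.subst (λ n → InDeg n (b j)) ∣S∣≡i (e-homogeneous (proj₁ (S-basis j)))
      where ∣S∣≡i = ≡.trans (≡.sym (proj₂ (proj₂ (S-basis j)))) (rank-x j)

    χ-basis : ∀ {j U} → Basis (x j) U → ∀ k → χ (x k) U ≡ ⟦ ⌊ j Fin.≟ k ⌋ ⟧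
    χ-basis {j} {U} U-basis k = ≡.cong ⟦_⟧ (⌊⌋-⇔ (basis? (x k) U) (j Fin.≟ k)
      (λ U-basis′ → x-injective (basis-unique U-basis U-basis′)) λ { ≡.refl → U-basis })

    coord-b : ∀ j k → coord (b k) j ≈ ⟦ ⌊ j Fin.≟ k ⌋ ⟧
    coord-b j k = trans (⟨,e⟩ (χ (x j)) (S k))
                        (reflexive (≡.trans (χ-basis (S-basis k) j) (≡.cong ⟦_⟧ (⌊≟⌋-sym Fin._≟_ k j))))

    coord-lincomb : ∀ a j → coord (lincomb b a) j ≈ a j
    coord-lincomb a j = begin
      coord (lincomb b a) j                      ≈⟨ ⟨⟩-lincomb (χ (x j)) b a ⟩
      ∑[ k ← allFin d ] (a k * coord (b k) j)
        ≈⟨ ∑-cong (allFin d) (λ k → trans (*-congˡ (coord-b j k)) (*-comm (a k) _)) ⟩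
      ∑[ k ← allFin d ] (⟦ ⌊ j Fin.≟ k ⌋ ⟧ * a k)  ≈⟨ ∑-δ Fin._≟_ a (Unique.allFin⁺ d) (∈-allFin j) ⟩
      a j                                        ∎

    independent : ∀ a → InIdeal (lincomb b a) → ∀ j → a j ≈ 0#
    independent a a∈I j = trans (sym (coord-lincomb a j)) (⟨χ,ideal⟩ (x j) a∈I)

    proj : Subset m → Elt
    proj U = lincomb b (λ k → χ (x k) U)

    residual : Subset m → Elt
    residual U = e U ⊖ proj U

    residual-∄basis : ∀ {U} → (∀ z → ¬ Basis z U) → residual U ≐ e U
    residual-∄basis {U} ∄basis W = begin
      e U W + - proj U W  ≈⟨ +-congˡ (trans (-x≈x _) proj≈0) ⟩
      e U W + 0#          ≈⟨ +-identityʳ _ ⟩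
      e U W               ∎
      where
      χ≈0 : ∀ k → χ (x k) U ≈ 0#
      χ≈0 k = ⟦⟧-false λ t → ∄basis (x k) (toWitness {a? = basis? (x k) U} t)
      proj≈0 : proj U W ≈ 0#
      proj≈0 = trans (reflexive (lincomb-apply b _ W))
                     (∑-zero (universal (λ k → trans (*-congʳ (χ≈0 k)) (zeroˡ (b k W))) (allFin d)))

    residual-basis : ∀ {U j} → Basis (x j) U → residual U ≐ (e U ⊖ b j)
    residual-basis {U} {j} U-basis W = +-congˡ (-‿cong (begin
      proj U W                                      ≡⟨ lincomb-apply b _ W ⟩
      ∑[ k ← allFin d ] (χ (x k) U * b k W)
        ≈⟨ ∑-cong (allFin d) (λ k → *-congʳ (reflexive (χ-basis U-basis k))) ⟩
      ∑[ k ← allFin d ] (⟦ ⌊ j Fin.≟ k ⌋ ⟧ * b k W)  ≈⟨ ∑-δ Fin._≟_ (λ k → b k W) (Unique.allFin⁺ d) (∈-allFin j) ⟩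
      b j W                                         ∎))

    reduce : ∀ {U} → AtomSet U → ∣ U ∣ ≡ i → ∀ k → InIdeal (k ⊙ residual U)
    reduce {U} atoms ∣U∣≡i k with Fin.any? (joinOf? U)
    ... | no ∄join =
      InIdeal-gen k (inj₁ (U , atoms , ∄join , λ _ → refl)) (residual-∄basis (∄join⇒¬basis ∄join))
    ... | yes (z , U∨z) with r z Nat.≟ ∣ U ∣
    ...   | no r[z]≢∣U∣ =
      InIdeal-gen k (inj₂ (inj₁ (U , z , atoms , U∨z , r[z]≢∣U∣ , λ _ → refl))) (residual-∄basis (rank≢⇒¬basis U∨z r[z]≢∣U∣))
    ...   | yes r[z]≡∣U∣ with x-surjective (≡.trans r[z]≡∣U∣ ∣U∣≡i)
    ...     | j , ≡.refl with U ≟S S j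
    ...       | yes ≡.refl = InIdeal-zero λ W →
      trans (*-congˡ (trans (residual-basis (S-basis j) W) (-‿inverseʳ (b j W)))) (zeroʳ k)
    ...       | no U≢S =
      let Sj-atoms , Sj∨x , r[x]≡∣Sj∣ = S-basis j
      in InIdeal-gen k (inj₂ (inj₂ (U , S j , x j , U≢S , atoms , Sj-atoms , U∨z , Sj∨x , r[z]≡∣U∣ , r[x]≡∣Sj∣ , λ _ → refl)))
                       (residual-basis (atoms , U∨z , r[z]≡∣U∣))

    ∑-proj : ∀ v W → ∑[ U ← 𝒫 ] (v U * proj U W) ≈ lincomb b (coord v) W
    ∑-proj v W = begin
      ∑[ U ← 𝒫 ] (v U * proj U W)
        ≈⟨ ∑-cong 𝒫 (λ U → trans (*-congˡ (reflexive (lincomb-apply b _ W))) (∑-*ˡ (allFin d) (v U) _)) ⟩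
      ∑[ U ← 𝒫 ] ∑[ k ← allFin d ] (v U * (χ (x k) U * b k W))
        ≈⟨ ∑-comm 𝒫 (allFin d) _ ⟩
      ∑[ k ← allFin d ] ∑[ U ← 𝒫 ] (v U * (χ (x k) U * b k W))
        ≈⟨ ∑-cong (allFin d) (λ k → trans (∑-cong 𝒫 λ U → x∙yz≈yx∙z (v U) _ _) (sym (∑-*ʳ 𝒫 (b k W) _))) ⟩
      ∑[ k ← allFin d ] (coord v k * b k W)
        ≡⟨ ≡.sym (lincomb-apply b (coord v) W) ⟩
      lincomb b (coord v) W ∎

    decomposition : ∀ v → (v ⊖ lincomb b (coord v)) ≐ ⨁ 𝒫 (λ U → v U ⊙ residual U)
    decomposition v W = begin
      v W + - lincomb b (coord v) W
        ≈⟨ +-cong (sym (expansion v W)) (trans (-x≈x _) (sym (∑-proj v W))) ⟩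
      ∑[ U ← 𝒫 ] (v U * e U W) + ∑[ U ← 𝒫 ] (v U * proj U W)
        ≈⟨ sym (∑-+ 𝒫 _ _) ⟩
      ∑[ U ← 𝒫 ] (v U * e U W + v U * proj U W)
        ≈⟨ ∑-cong 𝒫 (λ U → trans (sym (distribˡ (v U) _ _)) (*-congˡ (+-congˡ (sym (-x≈x _))))) ⟩
      ∑[ U ← 𝒫 ] (v U * residual U W)
        ≡⟨ ≡.sym (⨁-apply 𝒫 (λ U → v U ⊙ residual U) W) ⟩
      ⨁ 𝒫 (λ U → v U ⊙ residual U) W ∎

    spanning : ∀ v → InDeg i v → InIdeal (v ⊖ lincomb b (coord v))
    spanning v (ext , deg) = InIdeal-resp (λ W → sym (decomposition v W)) (InIdeal-⨁ 𝒫 _ reduced)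
      where
      -- Not a `with`: atomSet? U also occurs inside residual U, and abstracting it there is ill-typed.
      reduced′ : ∀ U → Dec (AtomSet U) → Dec (∣ U ∣ ≡ i) → InIdeal (v U ⊙ residual U)
      reduced′ U (no ¬atoms) _            = InIdeal-zero λ W → trans (*-congʳ (ext U ¬atoms)) (zeroˡ _)
      reduced′ U (yes _)     (no ∣U∣≢i)   = InIdeal-zero λ W → trans (*-congʳ (deg U ∣U∣≢i)) (zeroˡ _)
      reduced′ U (yes atoms) (yes ∣U∣≡i) = reduce atoms ∣U∣≡i (v U)
      reduced : ∀ U → InIdeal (v U ⊙ residual U)
      reduced U = reduced′ U (atomSet? U) (∣ U ∣ Nat.≟ i)

proposition3p2 : ∀ {c ℓ ℓo : Level} (K : Field c ℓ) → Char2 K →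
    (m : ℕ) (_≼_ : Rel (Fin m) ℓo) (_⊓_ : Fin m → Fin m → Fin m) →
    IsMeetSemilattice _≡_ _≼_ _⊓_ →
    (0̂ : Fin m) → Minimum _≼_ 0̂ →
    (r : Fin m → ℕ) →
    Poset.WithBottom.IsRank m _≼_ 0̂ r →
    Poset.WithBottom.Atomic m _≼_ 0̂ →
    Poset.WithBottom.Geometric m _≼_ 0̂ _⊓_ r →
    (i : ℕ) →
    Exterior.DimDeg K m _≼_ 0̂ r i (Poset.WithBottom.countRank m _≼_ 0̂ r i)
proposition3p2 K char2 m _≼_ _⊓_ isMeetSemilattice 0̂ 0̂-minimum r isRank atomic geometric i =
  b , b-homogeneous , independent , λ v v∈⋀ᵢ → coord v , spanning v v∈⋀ᵢ
  where
  open Char2Quotient K char2 m _≼_ _⊓_ isMeetSemilattice 0̂ 0̂-minimum r isRank geometric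
  open Degree atomic i
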